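{- Let $a,b$ be positive integers, $A=(a,a)$, $B=(b,b)$, and let $(S(i))_{i\ge0}$ be the ordered Markov sequences for $A$ and $B$. Then for every integer $k\ge1$, \[ |S(a(k))|=2d_k, \] where $|X|$ denotes the length of $X$ and $d_k$ is the $k$-th term of Stern's diatomic sequence.
   Context: For finite sequences $X,Y$, $X\oplus Y$ denotes concatenation. For a triple $(X,Y,Z)$ of finite sequences put $\mathcal{L}(X,Y,Z)=(X,X\oplus Y,Y)$ and $\mathcal{R}(X,Y,Z)=(Y,Y\oplus Z,Z)$. Let $v=(A,A\oplus B,B)$. For $m\ge1$ the $2^m$ triples at depth $m$ are $\varepsilon_m(\cdots\varepsilon_1(v)\cdots)$ for words $(\varepsilon_1,\ldots,\varepsilon_m)\in\{\mathcal{L},\mathcal{R}\}^m$ ($\varepsilon_1$ applied first), listed in lexicographic order with $\mathcal{L}<\mathcal{R}$. The ordered Markov sequences are $S(0)=A$, $S(1)=B$, $S(2)=A\oplus B$, and for $m\ge1$, $1\le i\le2^m$, $S(2^m+i)$ is the middle component of the $i$-th triple at depth $m$. The sequence $(a(j))_{j\ge1}$: $a(1)=a(2)=1$ and, for $j>1$, $a(2j)=a(j)$, $a(2j-1)=j$. Stern's diatomic sequence: $d_0=0$, $d_1=1$, $d_{2n}=d_n$, $d_{2n-1}=d_n+d_{n-1}$ for $n\ge1$. -}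

module Defs where

open import Data.Nat using (ℕ; zero; suc; _+_; _*_; _∸_; _≤ᵇ_; _^_)
open import Data.Nat.DivMod using (_/_; _%_)
open import Data.Bool using (Bool; true; false; if_then_else_)
open import Data.List using (List; []; _∷_; _++_; map; concat; length)
open import Data.Product using (_×_; _,_; proj₁; proj₂)

Seq : Set
Seq = List ℕ

_⊕_ : Seq → Seq → Seq
X ⊕ Y = X ++ Y

Triple : Set
Triple = Seq × Seq × Seq

middle : Triple → Seq
middle (_ , Y , _) = Y

data Side : Set where
  𝓛 𝓡 : Side

step : Side → Triple → Triple
step 𝓛 (X , Y , Z) = (X , X ⊕ Y , Y)
step 𝓡 (X , Y , Z) = (Y , Y ⊕ Z , Z)

-- apply (ε₁ ∷ ε₂ ∷ … ∷ εₘ) t = εₘ(⋯ε₁(t)⋯), ε₁ applied first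
apply : List Side → Triple → Triple
apply []       t = t
apply (e ∷ es) t = apply es (step e t)

-- all words of length m in lexicographic order, 𝓛 < 𝓡 (ε₁ most significant)
words : ℕ → List (List Side)
words zero    = [] ∷ []
words (suc m) = map (𝓛 ∷_) (words m) ++ map (𝓡 ∷_) (words m)

level : Seq → Seq → ℕ → List Seq
level A B m = map (λ w → middle (apply w (A , A ⊕ B , B))) (words m)

levelsUpTo : Seq → Seq → ℕ → List Seq
levelsUpTo A B zero    = []
levelsUpTo A B (suc M) = levelsUpTo A B M ++ level A B (suc M)

markovList : Seq → Seq → ℕ → List Seq
markovList A B M = A ∷ B ∷ (A ⊕ B) ∷ levelsUpTo A B M

nth : List Seq → ℕ → Seq
nth []       _       = []
nth (x ∷ xs) zero    = x
nth (x ∷ xs) (suc n) = nth xs n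

-- ordered Markov sequence S(n); the list markovList A B n has length
-- 2^(n+1)+1 > n, so index n is always in range (default [] never used)
S : Seq → Seq → ℕ → Seq
S A B n = nth (markovList A B n) n

-- the sequence a(j): a(1)=a(2)=1, a(2j)=a(j), a(2j-1)=j (j>1).
-- defined with fuel; fuel n suffices for argument n.
aF : ℕ → ℕ → ℕ
aF zero     n = 1
aF (suc f)  n =
  if n ≤ᵇ 2 then 1
  else (if n % 2 ≤ᵇ 0 then aF f (n / 2) else (n + 1) / 2)

aSeq : ℕ → ℕ
aSeq n = aF n n

sternF : ℕ → ℕ → ℕ
sternF zero    n = 0
sternF (suc f) zero = 0
sternF (suc f) (suc zero) = 1
sternF (suc f) n@(suc (suc _)) =
  if n % 2 ≤ᵇ 0 then sternF f (n / 2)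
  else sternF f ((n + 1) / 2) + sternF f ((n + 1) / 2 ∸ 1)

stern : ℕ → ℕ
stern n = sternF n n

-- Only lengths matter. Number the triples of the Markov tree as a binary heap: v is node 1,
-- and 𝓛, 𝓡 send node n to nodes 2n, 2n+1. As |A| = |B| = 2 and lengths add under ⊕, Stern's
-- recurrences d_{2n} = d_n, d_{2n+1} = d_n + d_{n+1} show that node n carries lengths
-- (2d_n, 2d_{2n+1}, 2d_{n+1}). Read level by level, S(j+1) is the middle of node j (with B as
-- node 0), so |S(j+1)| = 2d_{2j+1}. Now a(2n+1) = n+1 settles odd k, and a(2n) = a(n),
-- d_{2n} = d_n reduce even k to k/2.
module Submission where

open import Defs
open import Data.Nat using (ℕ; zero; suc; _+_; _*_; _^_; _≤_; _<_; z≤n; s≤s)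
open import Data.Nat.Properties
open import Data.Nat.DivMod using (_/_; _%_; m/n≡1+[m∸n]/n)
open import Data.Nat.Induction using (<-rec)
open import Data.Nat.Tactic.RingSolver using (solve-∀)
open import Data.List using ([]; _∷_; _++_; map; length; applyUpTo)
open import Data.List.Properties using (map-++; map-∘; length-++; ∷-injectiveˡ; ∷-injectiveʳ)
open import Data.Product using (_×_; _,_)
open import Function using (_∘_)
open import Relation.Binary.PropositionalEquality
  using (_≡_; refl; sym; trans; cong; cong₂; module ≡-Reasoning)

data Parity : ℕ → Set where
  even : ∀ n → Parity (n + n)
  odd  : ∀ n → Parity (suc (n + n))

parity : ∀ n → Parity n
parity zero = even 0
parity (suc n) with parity n
... | even m = odd m
... | odd m rewrite sym (+-suc m m) = even (suc m)

[2+m]/2≡1+m/2 : ∀ m → suc (suc m) / 2 ≡ suc (m / 2)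
[2+m]/2≡1+m/2 m = m/n≡1+[m∸n]/n {suc (suc m)} {2} (s≤s (s≤s z≤n))

[n+n]/2≡n : ∀ n → (n + n) / 2 ≡ n
[n+n]/2≡n zero = refl
[n+n]/2≡n (suc n) rewrite +-suc n n | [2+m]/2≡1+m/2 (n + n) = cong suc ([n+n]/2≡n n)

[n+n]%2≡0 : ∀ n → (n + n) % 2 ≡ 0
[n+n]%2≡0 zero = refl
[n+n]%2≡0 (suc n) rewrite +-suc n n = [n+n]%2≡0 n

[1+n+n]%2≡1 : ∀ n → suc (n + n) % 2 ≡ 1
[1+n+n]%2≡1 zero = refl
[1+n+n]%2≡1 (suc n) rewrite +-suc n n = [1+n+n]%2≡1 n

[3+n+n+1]/2≡2+n : ∀ n → (suc (suc (suc (n + n))) + 1) / 2 ≡ suc (suc n)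
[3+n+n+1]/2≡2+n n = begin
  (suc (suc (suc (n + n))) + 1) / 2  ≡⟨ cong (λ m → suc (suc (suc m)) / 2) (+-comm (n + n) 1) ⟩
  suc (suc (suc (suc (n + n)))) / 2  ≡⟨ [2+m]/2≡1+m/2 (suc (suc (n + n))) ⟩
  suc (suc (suc (n + n)) / 2)        ≡⟨ cong suc ([2+m]/2≡1+m/2 (n + n)) ⟩
  suc (suc ((n + n) / 2))            ≡⟨ cong (suc ∘ suc) ([n+n]/2≡n n) ⟩
  suc (suc n)                        ∎
  where open ≡-Reasoning

sternF-zero : ∀ f → sternF f 0 ≡ 0
sternF-zero zero = refl
sternF-zero (suc f) = refl

sternF-even : ∀ f n → sternF (suc f) (suc (suc (n + n))) ≡ sternF f (suc n)
sternF-even f n rewrite [n+n]%2≡0 n | [2+m]/2≡1+m/2 (n + n) | [n+n]/2≡n n = refl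

sternF-odd : ∀ f n → sternF (suc f) (suc (suc (suc (n + n)))) ≡ sternF f (suc (suc n)) + sternF f (suc n)
sternF-odd f n rewrite [1+n+n]%2≡1 n | [3+n+n+1]/2≡2+n n = refl

sternF-fuel : ∀ {f g} n → n ≤ f → n ≤ g → sternF f n ≡ sternF g n
sternF-fuel {f} {g} zero _ _ = trans (sternF-zero f) (sym (sternF-zero g))
sternF-fuel {suc f} {suc g} (suc zero) _ _ = refl
sternF-fuel {suc f} {suc g} (suc (suc m)) (s≤s m<f) (s≤s m<g) with parity m
... | even n rewrite sternF-even f n | sternF-even g n =
  sternF-fuel (suc n) (≤-trans 1+n≤1+n+n m<f) (≤-trans 1+n≤1+n+n m<g)
  where 1+n≤1+n+n = s≤s (m≤n+m n n)
... | odd n rewrite sternF-odd f n | sternF-odd g n =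
  cong₂ _+_ (sternF-fuel (suc (suc n)) (≤-trans 2+n≤2+n+n m<f) (≤-trans 2+n≤2+n+n m<g))
            (sternF-fuel (suc n) (≤-trans 1+n≤2+n+n m<f) (≤-trans 1+n≤2+n+n m<g))
  where 2+n≤2+n+n = s≤s (s≤s (m≤n+m n n))
        1+n≤2+n+n = s≤s (m≤n⇒m≤1+n (m≤n+m n n))

stern-double : ∀ n → stern (n + n) ≡ stern n
stern-double zero = refl
stern-double (suc n) rewrite +-suc n n =
  trans (sternF-even (suc (n + n)) n) (sternF-fuel (suc n) (s≤s (m≤n+m n n)) ≤-refl)

stern-odd : ∀ n → stern (suc (n + n)) ≡ stern n + stern (suc n)
stern-odd zero = refl
stern-odd (suc n) rewrite +-suc n n = begin
  sternF (suc f) (suc (suc (suc (n + n))))  ≡⟨ sternF-odd f n ⟩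
  sternF f (suc (suc n)) + sternF f (suc n)  ≡⟨ cong₂ _+_ (sternF-fuel (suc (suc n)) (s≤s (s≤s (m≤n+m n n))) ≤-refl)
                                                           (sternF-fuel (suc n) (s≤s (m≤n⇒m≤1+n (m≤n+m n n))) ≤-refl) ⟩
  stern (suc (suc n)) + stern (suc n)        ≡⟨ +-comm (stern (suc (suc n))) (stern (suc n)) ⟩
  stern (suc n) + stern (suc (suc n))        ∎
  where open ≡-Reasoning
        f = suc (suc (n + n))

aF-odd : ∀ f n → aF (suc f) (suc (suc (suc (n + n)))) ≡ suc (suc n)
aF-odd f n rewrite [1+n+n]%2≡1 n | [3+n+n+1]/2≡2+n n = refl

aF-even : ∀ f n → aF (suc f) (suc (suc (suc (suc (n + n))))) ≡ aF f (suc (suc n))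
aF-even f n rewrite [n+n]%2≡0 n | [2+m]/2≡1+m/2 (suc (suc (n + n))) | [2+m]/2≡1+m/2 (n + n) | [n+n]/2≡n n = refl

aF-zero : ∀ f → aF f 0 ≡ 1
aF-zero zero = refl
aF-zero (suc f) = refl

aF-fuel : ∀ {f g} n → n ≤ f → n ≤ g → aF f n ≡ aF g n
aF-fuel {f} {g} zero _ _ = trans (aF-zero f) (sym (aF-zero g))
aF-fuel {suc f} {suc g} (suc zero) _ _ = refl
aF-fuel {suc f} {suc g} (suc (suc zero)) _ _ = refl
aF-fuel {suc f} {suc g} (suc (suc (suc m))) (s≤s m<f) (s≤s m<g) with parity m
... | even n rewrite aF-odd f n | aF-odd g n = refl
... | odd n rewrite aF-even f n | aF-even g n =
  aF-fuel (suc (suc n)) (≤-trans 2+n≤3+n+n m<f) (≤-trans 2+n≤3+n+n m<g)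
  where 2+n≤3+n+n = s≤s (s≤s (m≤n⇒m≤1+n (m≤n+m n n)))

aSeq-odd : ∀ n → aSeq (suc (n + n)) ≡ suc n
aSeq-odd zero = refl
aSeq-odd (suc n) rewrite +-suc n n = aF-odd (suc (suc (n + n))) n

aSeq-even : ∀ n → aSeq (suc n + suc n) ≡ aSeq (suc n)
aSeq-even zero = refl
aSeq-even (suc n) rewrite +-suc n (suc n) | +-suc n n =
  trans (aF-even (suc (suc (suc (n + n)))) n) (aF-fuel (suc (suc n)) (s≤s (s≤s (m≤n⇒m≤1+n (m≤n+m n n)))) ≤-refl)

SternTriple : ℕ → Triple → Set
SternTriple n (X , Y , Z) =
  length X ≡ 2 * stern n × length Y ≡ length X + length Z × length Z ≡ 2 * stern (suc n)

markovLength : ℕ → ℕ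
markovLength n = 2 * stern (suc (n + n))

middle-length : ∀ {n} t → SternTriple n t → length (middle t) ≡ markovLength n
middle-length {n} (X , Y , Z) (|X| , |Y| , |Z|) = begin
  length Y                           ≡⟨ |Y| ⟩
  length X + length Z                ≡⟨ cong₂ _+_ |X| |Z| ⟩
  2 * stern n + 2 * stern (suc n)    ≡⟨ *-distribˡ-+ 2 (stern n) (stern (suc n)) ⟨
  2 * (stern n + stern (suc n))      ≡⟨ cong (2 *_) (stern-odd n) ⟨
  markovLength n                     ∎
  where open ≡-Reasoning

step-𝓛 : ∀ {n} t → SternTriple n t → SternTriple (n + n) (step 𝓛 t)
step-𝓛 {n} t@(X , Y , Z) st@(|X| , _ , _) =
  trans |X| (cong (2 *_) (sym (stern-double n))) , length-++ X , middle-length {n} t st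

step-𝓡 : ∀ {n} t → SternTriple n t → SternTriple (suc (n + n)) (step 𝓡 t)
step-𝓡 {n} t@(X , Y , Z) st@(_ , _ , |Z|) =
  middle-length {n} t st , length-++ Y , trans |Z| (cong (2 *_) (sym stern[2+n+n]≡stern[1+n]))
  where stern[2+n+n]≡stern[1+n] = trans (cong (stern ∘ suc) (sym (+-suc n n))) (stern-double (suc n))

applyUpTo-cong : ∀ {A : Set} {f g : ℕ → A} → (∀ i → f i ≡ g i) → ∀ n → applyUpTo f n ≡ applyUpTo g n
applyUpTo-cong f≗g zero = refl
applyUpTo-cong f≗g (suc n) = cong₂ _∷_ (f≗g 0) (applyUpTo-cong (f≗g ∘ suc) n)

applyUpTo-++ : ∀ {A : Set} (f : ℕ → A) m n → applyUpTo f (m + n) ≡ applyUpTo f m ++ applyUpTo (λ i → f (m + i)) n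
applyUpTo-++ f zero n = refl
applyUpTo-++ f (suc m) n = cong (f 0 ∷_) (applyUpTo-++ (f ∘ suc) m n)

middle-lengths-at-depth : ∀ {n} t m → SternTriple n t →
  map (λ w → length (middle (apply w t))) (words m) ≡ applyUpTo (λ i → markovLength (2 ^ m * n + i)) (2 ^ m)
middle-lengths-at-depth {n} t zero st =
  cong (_∷ []) (trans (middle-length {n} t st) (cong markovLength (sym 1*n+0≡n)))
  where 1*n+0≡n = trans (+-identityʳ (1 * n)) (*-identityˡ n)
middle-lengths-at-depth {n} t (suc m) st = begin
  map ℓ (map (𝓛 ∷_) (words m) ++ map (𝓡 ∷_) (words m))
    ≡⟨ map-++ ℓ (map (𝓛 ∷_) (words m)) (map (𝓡 ∷_) (words m)) ⟩
  map ℓ (map (𝓛 ∷_) (words m)) ++ map ℓ (map (𝓡 ∷_) (words m))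
    ≡⟨ cong₂ _++_ (map-∘ (words m)) (map-∘ (words m)) ⟨
  map (ℓ ∘ (𝓛 ∷_)) (words m) ++ map (ℓ ∘ (𝓡 ∷_)) (words m)
    ≡⟨ cong₂ _++_ (middle-lengths-at-depth (step 𝓛 t) m (step-𝓛 {n} t st))
                  (middle-lengths-at-depth (step 𝓡 t) m (step-𝓡 {n} t st)) ⟩
  applyUpTo (λ i → markovLength (p * (n + n) + i)) p ++ applyUpTo (λ i → markovLength (p * suc (n + n) + i)) p
    ≡⟨ cong₂ _++_ (applyUpTo-cong (cong markovLength ∘ left-child p n) p)
                  (applyUpTo-cong (cong markovLength ∘ right-child p n) p) ⟩
  applyUpTo g p ++ applyUpTo (λ i → g (p + i)) p
    ≡⟨ applyUpTo-++ g p p ⟨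
  applyUpTo g (p + p)
    ≡⟨ cong (applyUpTo g) (cong (p +_) (+-identityʳ p)) ⟨
  applyUpTo g (2 ^ suc m)
    ∎
  where
    open ≡-Reasoning
    ℓ = λ w → length (middle (apply w t))
    p = 2 ^ m
    g = λ i → markovLength (2 * p * n + i)
    left-child : ∀ p n i → p * (n + n) + i ≡ 2 * p * n + i
    left-child = solve-∀
    right-child : ∀ p n i → p * suc (n + n) + i ≡ 2 * p * n + (p + i)
    right-child = solve-∀

length-nth : ∀ {f N} L j → map length L ≡ applyUpTo f N → j < N → length (nth L j) ≡ f j
length-nth {N = suc N} (X ∷ L) zero lengths _ = ∷-injectiveˡ lengths
length-nth {N = suc N} (X ∷ L) (suc j) lengths (s≤s j<N) = length-nth L j (∷-injectiveʳ lengths) j<N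

n<2^n : ∀ n → n < 2 ^ n
n<2^n zero = s≤s z≤n
n<2^n (suc n) = +-mono-≤ (m^n>0 2 n) (≤-trans (n<2^n n) (m≤m+n (2 ^ n) 0))

module _ {A B : Seq} (|A|≡2 : length A ≡ 2) (|B|≡2 : length B ≡ 2) where

  SternTriple-root : SternTriple 1 (A , A ⊕ B , B)
  SternTriple-root = |A|≡2 , length-++ A , |B|≡2

  level-lengths : ∀ m → map length (level A B m) ≡ applyUpTo (λ i → markovLength (2 ^ m + i)) (2 ^ m)
  level-lengths m = begin
    map length (level A B m)   ≡⟨ map-∘ (words m) ⟨
    map (λ w → length (middle (apply w (A , A ⊕ B , B)))) (words m)
                               ≡⟨ middle-lengths-at-depth _ m SternTriple-root ⟩
    applyUpTo (λ i → markovLength (2 ^ m * 1 + i)) (2 ^ m)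
                               ≡⟨ applyUpTo-cong (λ i → cong (λ x → markovLength (x + i)) (*-identityʳ (2 ^ m))) (2 ^ m) ⟩
    applyUpTo (λ i → markovLength (2 ^ m + i)) (2 ^ m) ∎
    where open ≡-Reasoning

  markov-lengths : ∀ M → map length (B ∷ (A ⊕ B) ∷ levelsUpTo A B M) ≡ applyUpTo markovLength (2 ^ suc M)
  markov-lengths zero = cong₂ _∷_ |B|≡2 (cong (_∷ []) (trans (length-++ A) (cong₂ _+_ |A|≡2 |B|≡2)))
  markov-lengths (suc M) = begin
    map length ((B ∷ (A ⊕ B) ∷ levelsUpTo A B M) ++ level A B (suc M))
      ≡⟨ map-++ length (B ∷ (A ⊕ B) ∷ levelsUpTo A B M) (level A B (suc M)) ⟩
    map length (B ∷ (A ⊕ B) ∷ levelsUpTo A B M) ++ map length (level A B (suc M))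
      ≡⟨ cong₂ _++_ (markov-lengths M) (level-lengths (suc M)) ⟩
    applyUpTo markovLength p ++ applyUpTo (λ i → markovLength (p + i)) p
      ≡⟨ applyUpTo-++ markovLength p p ⟨
    applyUpTo markovLength (p + p)
      ≡⟨ cong (λ q → applyUpTo markovLength (p + q)) (+-identityʳ p) ⟨
    applyUpTo markovLength (2 ^ suc (suc M)) ∎
    where open ≡-Reasoning
          p = 2 ^ suc M

  length-S-suc : ∀ j → length (S A B (suc j)) ≡ markovLength j
  length-S-suc j = length-nth (B ∷ (A ⊕ B) ∷ levelsUpTo A B (suc j)) j (markov-lengths (suc j))
                              (<-≤-trans (n<2^n j) (^-monoʳ-≤ 2 (m≤n+m j 2)))

  length-S-aSeq : ∀ k → 1 ≤ k → length (S A B (aSeq k)) ≡ 2 * stern k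
  length-S-aSeq = <-rec _ go
    where
    open ≡-Reasoning
    go : ∀ k → (∀ {j} → j < k → 1 ≤ j → length (S A B (aSeq j)) ≡ 2 * stern j) →
         1 ≤ k → length (S A B (aSeq k)) ≡ 2 * stern k
    go k rec _ with parity k
    go _ _ _ | odd n = begin
      length (S A B (aSeq (suc (n + n))))  ≡⟨ cong (length ∘ S A B) (aSeq-odd n) ⟩
      length (S A B (suc n))               ≡⟨ length-S-suc n ⟩
      2 * stern (suc (n + n))              ∎
    go _ _ () | even zero
    go _ rec _ | even (suc n) = begin
      length (S A B (aSeq (suc n + suc n)))  ≡⟨ cong (length ∘ S A B) (aSeq-even n) ⟩
      length (S A B (aSeq (suc n)))          ≡⟨ rec (m<m+n (suc n) (s≤s z≤n)) (s≤s z≤n) ⟩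
      2 * stern (suc n)                      ≡⟨ cong (2 *_) (stern-double (suc n)) ⟨
      2 * stern (suc n + suc n)              ∎

lemma2p12 : (a b : ℕ) → 1 ≤ a → 1 ≤ b → (k : ℕ) → 1 ≤ k →
    length (S (a ∷ a ∷ []) (b ∷ b ∷ []) (aSeq k)) ≡ 2 * stern k
lemma2p12 a b _ _ = length-S-aSeq refl refl
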